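{- Let $A$ and $U$ be disjoint subsets of an arc of $\mathrm{V}_k(\mathbb{F}_q)$ with $|A|=k-2$ and $|U|=n+1$. Let $$\psi(X)=\sum_{w\in U}\lambda_w\prod_{u\in U\setminus\{w\}}(u\cdot X),$$ for some $\lambda_w\in\mathbb{F}_q$, where $X$ ranges over $\mathbb{F}_q^k$. If $\psi$ vanishes at $n+1$ distinct points of the line $A$ of the dual space, then $\psi$ is identically zero (i.e. all $\lambda_w=0$).
   Context: An arc of $\mathrm{V}_k(\mathbb{F}_q)=\mathbb{F}_q^k$ is a set of vectors any $k$ of which are linearly independent. Here $u\cdot X$ denotes the standard scalar product. Points of the dual space are $1$-dimensional subspaces of $\mathbb{F}_q^k$ (viewed as dual vectors); the line $A$ of the dual space is the $2$-dimensional subspace $\{x\in\mathbb{F}_q^k: a\cdot x=0 \text{ for all } a\in A\}$, and its points are its $1$-dimensional subspaces. Since $\psi$ is homogeneous, vanishing at a point is well defined. In particular, for an ordered $(k-1)$-subset $C=\{p_1,\ldots,p_{k-1}\}$ of the arc, the vector $x_C$ with $j$-th coordinate $(-1)^{j+1}\det(p_1,\ldots,p_{k-1})$ (the $j$-th coordinate of each $p_i$ deleted) satisfies $u\cdot x_C=\det(u,p_1,\ldots,p_{k-1})$, and if $A\subseteq C$ then $\langle x_C\rangle$ is a point on the line $A$. -}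

module Defs where

open import Level using (Level; _⊔_) renaming (suc to lsuc)
open import Data.Nat using (ℕ; zero; suc)
open import Data.Fin using (Fin; zero; suc; _≟_)
open import Data.Product using (Σ)
open import Relation.Nullary using (¬_; does)
open import Data.Bool using (if_then_else_)
open import Algebra.Bundles using (CommutativeRing)
open import Relation.Binary.PropositionalEquality using (_≡_)

record FiniteField (c ℓ : Level) : Set (lsuc (c ⊔ ℓ)) where
  field
    commutativeRing : CommutativeRing c ℓ
  open CommutativeRing commutativeRing public
  field
    0≉1       : ¬ (0# ≈ 1#)
    inverse   : ∀ x → ¬ (x ≈ 0#) → Σ Carrier (λ y → (x * y) ≈ 1#)
    q         : ℕ
    enum      : Fin q → Carrier
    enum-surj : ∀ x → Σ (Fin q) (λ i → enum i ≈ x)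

module Geometry {c ℓ : Level} (F : FiniteField c ℓ) where
  open FiniteField F using (Carrier; _≈_; 0#; 1#; _+_; _*_)

  Vect : ℕ → Set c
  Vect k = Fin k → Carrier

  ∑ : ∀ {m} → (Fin m → Carrier) → Carrier
  ∑ {zero}  f = 0#
  ∑ {suc m} f = f zero + ∑ (λ i → f (suc i))

  ∏ : ∀ {m} → (Fin m → Carrier) → Carrier
  ∏ {zero}  f = 1#
  ∏ {suc m} f = f zero * ∏ (λ i → f (suc i))

  _·_ : ∀ {k} → Vect k → Vect k → Carrier
  u · x = ∑ (λ j → u j * x j)

  LinIndep : ∀ {m k} → (Fin m → Vect k) → Set (c ⊔ ℓ)
  LinIndep {m} {k} v =
    (coef : Fin m → Carrier) →
    (∀ j → ∑ (λ i → coef i * v i j) ≈ 0#) →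
    ∀ i → coef i ≈ 0#

  IsArc : ∀ {N k} → (Fin N → Vect k) → Set (c ⊔ ℓ)
  IsArc {N} {k} P =
    (s : Fin k → Fin N) → (∀ i j → s i ≡ s j → i ≡ j) →
    LinIndep (λ i → P (s i))

  ψ : ∀ {m k} → (Fin m → Carrier) → (Fin m → Vect k) → Vect k → Carrier
  ψ lam U X = ∑ (λ w → lam w * ∏ (λ u → if does (u ≟ w) then 1# else (U u · X)))
  open FiniteField F public using (Carrier; _≈_; 0#; _*_)

module Submission where

open import Defs
open import Data.Nat using (ℕ; zero; suc; _≤_; _∸_; s≤s; z≤n)
open import Data.Fin using (Fin; zero)
open import Data.Product using (Σ)
open import Relation.Nullary using (¬_)
open import Relation.Binary.PropositionalEquality using (_≡_; _≢_)
open import Algebra.Bundles using (CommutativeRing)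

-- For |U| ≥ 2 take two elements of U as coordinate forms on the
-- line A.  Because A ∪ {u, w} consists of k points of the arc, a point
-- of A killed by two forms of U is 0; hence distinct forms of U are
-- independent on A and distinct points of A have independent
-- coordinates.  In these coordinates ψ restricted to A is a binary form
-- G of degree n with n+1 pairwise non-proportional roots, so G = 0; and
-- evaluating G at the zero of the w-th linear factor leaves λ_w times a
-- nonzero product, so λ_w = 0.

module IntegerCoefficients {c ℓ} (R : CommutativeRing c ℓ) where

  open CommutativeRing R
  open import Data.Nat as ℕ using (ℕ; zero; suc)
  open import Data.Integer as ℤ using (ℤ; +_; -[1+_])
  import Data.Integer.Properties as ℤ
  open import Data.Sign as Sign using (Sign)
  open import Data.Maybe using (Maybe; just; nothing)
  open import Relation.Nullary using (yes; no)
  open import Relation.Binary.PropositionalEquality as ≡ using (_≡_)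
  open import Relation.Binary.Reasoning.Setoid setoid
  open import Algebra.Properties.Ring ring using (-0#≈0#; -‿involutive; -‿+-comm; -‿distribˡ-*; -‿distribʳ-*)
  open import Algebra.Properties.Semiring.Mult.TCOptimised semiring using (_×_; 1+×; ×-homo-+; ×1-homo-*)
  open import Data.Nat.Properties using (+-suc)
  import Algebra.Solver.Ring.AlmostCommutativeRing as ACR

  ⟨_⟩ : ℕ → Carrier
  ⟨ n ⟩ = n × 1#

  signed : Sign → Carrier → Carrier
  signed Sign.+ x = x
  signed Sign.- x = - x

  signed-cong : ∀ s {x y} → x ≈ y → signed s x ≈ signed s y
  signed-cong Sign.+ x≈y = x≈y
  signed-cong Sign.- x≈y = -‿cong x≈y

  signed-* : ∀ s t x y → signed (s Sign.* t) (x * y) ≈ signed s x * signed t y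
  signed-* Sign.+ Sign.+ x y = refl
  signed-* Sign.+ Sign.- x y = -‿distribʳ-* x y
  signed-* Sign.- Sign.+ x y = -‿distribˡ-* x y
  signed-* Sign.- Sign.- x y = begin
    x * y           ≈⟨ *-congʳ (-‿involutive x) ⟨
    - - x * y       ≈⟨ -‿distribˡ-* (- x) y ⟨
    - (- x * y)     ≈⟨ -‿distribʳ-* (- x) y ⟩
    - x * - y       ∎

  ι : ℤ → Carrier
  ι (+ n)    = ⟨ n ⟩
  ι -[1+ n ] = - ⟨ suc n ⟩

  ι-sign-abs : ∀ i → ι i ≈ signed (ℤ.sign i) ⟨ ℤ.∣ i ∣ ⟩
  ι-sign-abs (+ n)    = refl
  ι-sign-abs -[1+ n ] = refl

  ι-◃ : ∀ s n → ι (s ℤ.◃ n) ≈ signed s ⟨ n ⟩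
  ι-◃ Sign.+ zero    = refl
  ι-◃ Sign.- zero    = sym -0#≈0#
  ι-◃ Sign.+ (suc n) = refl
  ι-◃ Sign.- (suc n) = refl

  cancel-1 : ∀ x y → (1# + x) - (1# + y) ≈ x - y
  cancel-1 x y = begin
    (1# + x) + - (1# + y)   ≈⟨ +-congˡ (-‿+-comm 1# y) ⟨
    (1# + x) + (- 1# + - y) ≈⟨ +-congʳ (+-comm 1# x) ⟩
    (x + 1#) + (- 1# + - y) ≈⟨ +-assoc x 1# _ ⟩
    x + (1# + (- 1# + - y)) ≈⟨ +-congˡ (+-assoc 1# (- 1#) (- y)) ⟨
    x + ((1# - 1#) + - y)   ≈⟨ +-congˡ (+-congʳ (-‿inverseʳ 1#)) ⟩
    x + (0# + - y)          ≈⟨ +-congˡ (+-identityˡ (- y)) ⟩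
    x - y                   ∎

  ι-⊖ : ∀ m n → ι (m ℤ.⊖ n) ≈ ⟨ m ⟩ - ⟨ n ⟩
  ι-⊖ zero    zero    = sym (-‿inverseʳ 0#)
  ι-⊖ zero    (suc n) = sym (+-identityˡ _)
  ι-⊖ (suc m) zero    = sym (trans (+-congˡ -0#≈0#) (+-identityʳ _))
  ι-⊖ (suc m) (suc n) = begin
    ι (suc m ℤ.⊖ suc n) ≡⟨ ≡.cong ι (ℤ.[1+m]⊖[1+n]≡m⊖n m n) ⟩
    ι (m ℤ.⊖ n)         ≈⟨ ι-⊖ m n ⟩
    ⟨ m ⟩ - ⟨ n ⟩       ≈⟨ cancel-1 ⟨ m ⟩ ⟨ n ⟩ ⟨
    (1# + ⟨ m ⟩) - (1# + ⟨ n ⟩) ≈⟨ +-cong (1+× m 1#) (-‿cong (1+× n 1#)) ⟨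
    ⟨ suc m ⟩ - ⟨ suc n ⟩ ∎

  ι-+ : ∀ i j → ι (i ℤ.+ j) ≈ ι i + ι j
  ι-+ -[1+ m ] -[1+ n ] = begin
    - ⟨ suc (suc (m ℕ.+ n)) ⟩      ≡⟨ ≡.cong (λ k → - ⟨ suc k ⟩) (+-suc m n) ⟨
    - ⟨ suc m ℕ.+ suc n ⟩          ≈⟨ -‿cong (×-homo-+ 1# (suc m) (suc n)) ⟩
    - (⟨ suc m ⟩ + ⟨ suc n ⟩)      ≈⟨ -‿+-comm _ _ ⟨
    - ⟨ suc m ⟩ + - ⟨ suc n ⟩      ∎
  ι-+ -[1+ m ] (+ n)    = trans (ι-⊖ n (suc m)) (+-comm _ _)
  ι-+ (+ m)    -[1+ n ] = ι-⊖ m (suc n)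
  ι-+ (+ m)    (+ n)    = ×-homo-+ 1# m n

  ι-* : ∀ i j → ι (i ℤ.* j) ≈ ι i * ι j
  ι-* i j = begin
    ι (s ℤ.◃ ℤ.∣ i ∣ ℕ.* ℤ.∣ j ∣)           ≈⟨ ι-◃ s (ℤ.∣ i ∣ ℕ.* ℤ.∣ j ∣) ⟩
    signed s ⟨ ℤ.∣ i ∣ ℕ.* ℤ.∣ j ∣ ⟩         ≈⟨ signed-cong s (×1-homo-* ℤ.∣ i ∣ ℤ.∣ j ∣) ⟩
    signed s (⟨ ℤ.∣ i ∣ ⟩ * ⟨ ℤ.∣ j ∣ ⟩)     ≈⟨ signed-* (ℤ.sign i) (ℤ.sign j) _ _ ⟩
    signed (ℤ.sign i) ⟨ ℤ.∣ i ∣ ⟩ * signed (ℤ.sign j) ⟨ ℤ.∣ j ∣ ⟩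
                                            ≈⟨ *-cong (ι-sign-abs i) (ι-sign-abs j) ⟨
    ι i * ι j                               ∎
    where s = ℤ.sign i Sign.* ℤ.sign j

  ι-neg : ∀ i → ι (ℤ.- i) ≈ - ι i
  ι-neg -[1+ n ]    = sym (-‿involutive _)
  ι-neg (+ zero)    = sym -0#≈0#
  ι-neg (+ (suc n)) = refl

  ι-homomorphism : ℤ.+-*-rawRing ACR.-Raw-AlmostCommutative⟶ ACR.fromCommutativeRing R
  ι-homomorphism = record
    { ⟦_⟧ = ι ; +-homo = ι-+ ; *-homo = ι-* ; -‿homo = ι-neg ; 0-homo = refl ; 1-homo = refl }

  ι-equal? : ∀ i j → Maybe (ι i ≈ ι j)
  ι-equal? i j with i ℤ.≟ j
  ... | yes ≡.refl = just refl
  ... | no _       = nothing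

  open import Algebra.Solver.Ring ℤ.+-*-rawRing (ACR.fromCommutativeRing R) ι-homomorphism ι-equal? public

module Determinant {c ℓ} (R : CommutativeRing c ℓ) where

  open CommutativeRing R hiding (zero)
  open IntegerCoefficients R using (solve; con; _:+_; _:*_; _:-_; _:=_)
  open import Data.Integer using (+_)
  open import Data.Nat using (ℕ; zero; suc)
  open import Data.Fin using (Fin; zero; suc; punchIn)
  open import Data.Vec.Functional using (_∷_)
  open import Level using (_⊔_)
  open import Relation.Binary.PropositionalEquality as ≡ using (_≡_)
  open import Relation.Binary.Reasoning.Setoid setoid

  alt : ∀ {n} → (Fin n → Carrier) → Carrier
  alt {zero}  f = 0#
  alt {suc n} f = f zero - alt (λ i → f (suc i))

  alt-cong : ∀ {n} {f g : Fin n → Carrier} → (∀ i → f i ≈ g i) → alt f ≈ alt g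
  alt-cong {zero}  f≈g = refl
  alt-cong {suc n} f≈g = +-cong (f≈g zero) (-‿cong (alt-cong (λ i → f≈g (suc i))))

  alt-zero : ∀ {n} {f : Fin n → Carrier} → (∀ i → f i ≈ 0#) → alt f ≈ 0#
  alt-zero {zero}  f≈0 = refl
  alt-zero {suc n} {f} f≈0 = begin
    f zero - alt (λ i → f (suc i)) ≈⟨ +-cong (f≈0 zero) (-‿cong (alt-zero (λ i → f≈0 (suc i)))) ⟩
    0# - 0#                        ≈⟨ -‿inverseʳ 0# ⟩
    0#                             ∎

  alt-*ˡ : ∀ {n} x (f : Fin n → Carrier) → x * alt f ≈ alt (λ i → x * f i)
  alt-*ˡ {zero}  x f = zeroʳ x
  alt-*ˡ {suc n} x f = begin
    x * (f zero - alt (λ i → f (suc i)))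
      ≈⟨ solve 3 (λ x a b → x :* (a :- b) := x :* a :- x :* b) refl x (f zero) _ ⟩
    x * f zero - x * alt (λ i → f (suc i))
      ≈⟨ +-congˡ (-‿cong (alt-*ˡ x (λ i → f (suc i)))) ⟩
    x * f zero - alt (λ i → x * f (suc i)) ∎

  alt-− : ∀ {n} (f g : Fin n → Carrier) → alt (λ i → f i - g i) ≈ alt f - alt g
  alt-− {zero}  f g = sym (-‿inverseʳ 0#)
  alt-− {suc n} f g = begin
    (f zero - g zero) - alt (λ i → f (suc i) - g (suc i))
      ≈⟨ +-congˡ (-‿cong (alt-− (λ i → f (suc i)) (λ i → g (suc i)))) ⟩
    (f zero - g zero) - (alt (λ i → f (suc i)) - alt (λ i → g (suc i)))
      ≈⟨ solve 4 (λ a b c d → (a :- b) :- (c :- d) := (a :- c) :- (b :- d)) refl (f zero) (g zero) _ _ ⟩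
    alt f - alt g ∎

  -- Laplace-type expansions of a "multilinear form" ρ evaluated on a
  -- family w of m+1 rows (of arbitrary type X), along a functional a:
  --   expand a w ρ = Σ_s (-1)^s a(w s) ρ(w without row s).
  module _ {X : Set c} where

    expand : ∀ {m} → (X → Carrier) → (Fin (suc m) → X) → ((Fin m → X) → Carrier) → Carrier
    expand a w ρ = alt (λ s → a (w s) * ρ (λ i → w (punchIn s i)))

    -- ρ only depends on the values of the family (there is no funext)
    Extensional : ∀ {m} → ((Fin m → X) → Carrier) → Set (c ⊔ ℓ)
    Extensional ρ = ∀ f g → (∀ i → f i ≡ g i) → ρ f ≈ ρ g

    pin-extensional : ∀ {m} (ρ : (Fin (suc m) → X) → Carrier) → Extensional ρ →
                      ∀ x → Extensional (λ f → ρ (x ∷ f))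
    pin-extensional ρ ext x f g f≡g = ext _ _ λ { zero → ≡.refl ; (suc i) → f≡g i }

    expand₂ : ∀ {m} → (a b : X → Carrier) → (Fin (suc (suc m)) → X) → ((Fin m → X) → Carrier) → Carrier
    expand₂ a b w ρ = expand a w (λ w′ → expand b w′ ρ)

    -- the part of expand₂ in which neither expansion hits row 0
    untouched₀ : ∀ {m} → (a b : X → Carrier) → (Fin (suc (suc m)) → X) → ((Fin m → X) → Carrier) → Carrier
    untouched₀ a b w ρ = alt (λ s → a (w (suc s)) *
      alt (λ t → b (w (suc (punchIn s t))) * ρ (λ i → w (punchIn (suc s) (punchIn (suc t) i)))))

    expand₂-split : ∀ {m} (a b : X → Carrier) (w : Fin (suc (suc m)) → X) ρ →
      expand₂ a b w ρ ≈ (a (w zero) * expand b (λ i → w (suc i)) ρ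
                         - b (w zero) * expand a (λ i → w (suc i)) ρ) + untouched₀ a b w ρ
    expand₂-split {m} a b w ρ = begin
      a₀ * Sb - alt (λ s → a (w (suc s)) * (b₀ * ρ₀ s - T s)) ≈⟨ +-congˡ (-‿cong inner) ⟩
      a₀ * Sb - (b₀ * Sa - untouched₀ a b w ρ)
        ≈⟨ solve 5 (λ a₀ sb b₀ sa t → a₀ :* sb :- (b₀ :* sa :- t) := (a₀ :* sb :- b₀ :* sa) :+ t)
                   refl a₀ Sb b₀ Sa (untouched₀ a b w ρ) ⟩
      (a₀ * Sb - b₀ * Sa) + untouched₀ a b w ρ ∎
      where
      a₀ b₀ Sa Sb : Carrier
      a₀ = a (w zero)
      b₀ = b (w zero)
      Sa = expand a (λ i → w (suc i)) ρ
      Sb = expand b (λ i → w (suc i)) ρ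
      ρ₀ T : Fin (suc m) → Carrier
      ρ₀ s = ρ (λ i → w (suc (punchIn s i)))
      T s = alt (λ t → b (w (suc (punchIn s t))) * ρ (λ i → w (punchIn (suc s) (punchIn (suc t) i))))
      inner : alt (λ s → a (w (suc s)) * (b₀ * ρ₀ s - T s)) ≈ b₀ * Sa - untouched₀ a b w ρ
      inner = begin
        alt (λ s → a (w (suc s)) * (b₀ * ρ₀ s - T s))
          ≈⟨ alt-cong (λ s → solve 4 (λ x y r t → x :* (y :* r :- t) := y :* (x :* r) :- x :* t)
                                    refl (a (w (suc s))) b₀ (ρ₀ s) (T s)) ⟩
        alt (λ s → b₀ * (a (w (suc s)) * ρ₀ s) - a (w (suc s)) * T s)
          ≈⟨ alt-− (λ s → b₀ * (a (w (suc s)) * ρ₀ s)) (λ s → a (w (suc s)) * T s) ⟩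
        alt (λ s → b₀ * (a (w (suc s)) * ρ₀ s)) - untouched₀ a b w ρ
          ≈⟨ +-congʳ (alt-*ˡ b₀ (λ s → a (w (suc s)) * ρ₀ s)) ⟨
        b₀ * Sa - untouched₀ a b w ρ ∎

    untouched₀-2 : ∀ (a b : X → Carrier) (w : Fin 2 → X) ρ → untouched₀ a b w ρ ≈ 0#
    untouched₀-2 a b w ρ = alt-zero {f = λ s → a (w (suc s)) * 0#} (λ s → zeroʳ _)

    untouched₀-pin : ∀ {m} (a b : X → Carrier) (w : Fin (suc (suc (suc m))) → X) ρ → Extensional ρ →
      untouched₀ a b w ρ ≈ expand₂ a b (λ i → w (suc i)) (λ f → ρ (w zero ∷ f))
    untouched₀-pin a b w ρ ext =
      alt-cong λ s → *-congˡ {a (w (suc s))} (alt-cong λ t → *-congˡ {b (w (suc (punchIn s t)))}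
        (ext (λ i → w (punchIn (suc s) (punchIn (suc t) i))) (w zero ∷ (λ i → w (suc (punchIn s (punchIn t i)))))
             λ { zero → ≡.refl ; (suc i) → ≡.refl }))

    expand₂-antisym : ∀ {m} (a b : X → Carrier) (w : Fin (suc (suc m)) → X) ρ → Extensional ρ →
      expand₂ a b w ρ + expand₂ b a w ρ ≈ 0#
    expand₂-antisym {m} a b w ρ ext = begin
      expand₂ a b w ρ + expand₂ b a w ρ
        ≈⟨ +-cong (expand₂-split a b w ρ) (expand₂-split b a w ρ) ⟩
      ((a₀ * Sb - b₀ * Sa) + untouched₀ a b w ρ) + ((b₀ * Sa - a₀ * Sb) + untouched₀ b a w ρ)
        ≈⟨ solve 6 (λ x y z u t t′ → ((x :* y :- z :* u) :+ t) :+ ((z :* u :- x :* y) :+ t′) := t :+ t′)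
                   refl a₀ Sb b₀ Sa _ _ ⟩
      untouched₀ a b w ρ + untouched₀ b a w ρ ≈⟨ untouched m w ρ ext ⟩
      0# ∎
      where
      a₀ = a (w zero)
      b₀ = b (w zero)
      Sa = expand a (λ i → w (suc i)) ρ
      Sb = expand b (λ i → w (suc i)) ρ
      untouched : ∀ m (w : Fin (suc (suc m)) → X) ρ → Extensional ρ →
                  untouched₀ a b w ρ + untouched₀ b a w ρ ≈ 0#
      untouched zero    w ρ ext = trans (+-cong (untouched₀-2 a b w ρ) (untouched₀-2 b a w ρ)) (+-identityˡ 0#)
      untouched (suc m) w ρ ext = trans (+-cong (untouched₀-pin a b w ρ ext) (untouched₀-pin b a w ρ ext))
        (expand₂-antisym a b (λ i → w (suc i)) _ (pin-extensional ρ ext (w zero)))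

    expand₂-diag : ∀ {m} (a : X → Carrier) (w : Fin (suc (suc m)) → X) ρ → Extensional ρ →
      expand₂ a a w ρ ≈ 0#
    expand₂-diag {m} a w ρ ext = begin
      expand₂ a a w ρ                       ≈⟨ expand₂-split a a w ρ ⟩
      (a₀ * Sa - a₀ * Sa) + untouched₀ a a w ρ ≈⟨ +-cong (-‿inverseʳ _) (untouched m w ρ ext) ⟩
      0# + 0#                                ≈⟨ +-identityˡ 0# ⟩
      0# ∎
      where
      a₀ = a (w zero)
      Sa = expand a (λ i → w (suc i)) ρ
      untouched : ∀ m (w : Fin (suc (suc m)) → X) ρ → Extensional ρ → untouched₀ a a w ρ ≈ 0#
      untouched zero    w ρ ext = untouched₀-2 a a w ρ
      untouched (suc m) w ρ ext = trans (untouched₀-pin a a w ρ ext)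
        (expand₂-diag a (λ i → w (suc i)) _ (pin-extensional ρ ext (w zero)))

  Matrix : ℕ → ℕ → Set c
  Matrix m n = Fin m → Fin n → Carrier

  det : ∀ {n} → Matrix n n → Carrier
  det {zero}  v = 1#
  det {suc n} v = expand (λ row → row zero) v (λ rows → det (λ i j → rows i (suc j)))

  det-cong : ∀ {n} {v v′ : Matrix n n} → (∀ i j → v i j ≈ v′ i j) → det v ≈ det v′
  det-cong {zero}  v≈v′ = refl
  det-cong {suc n} v≈v′ = alt-cong (λ s → *-cong (v≈v′ s zero) (det-cong (λ i j → v≈v′ (punchIn s i) (suc j))))

  minor : ∀ {n} → Matrix n (suc n) → Carrier
  minor rows = det (λ i j → rows i (suc j))

  minor-extensional : ∀ {n} → Extensional (minor {n})
  minor-extensional f g f≡g = det-cong (λ i j → reflexive (≡.cong (λ row → row (suc j)) (f≡g i)))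

  -- Laplace expansion of the (n+1)×(n+1) matrix whose first column is a
  -- copy of column l of the (n+1)×n matrix v
  columnExpansion : ∀ {n} → Matrix (suc n) n → Fin n → Carrier
  columnExpansion v l = expand (λ row → row l) v det

  -- ... vanishes, since that matrix has two equal columns
  columnExpansion-zero : ∀ n (v : Matrix (suc n) n) l → columnExpansion v l ≈ 0#
  columnExpansion-zero (suc n) v zero    = expand₂-diag (λ row → row zero) v minor minor-extensional
  columnExpansion-zero (suc n) v (suc l) = begin
    E-l0                   ≈⟨ solve 2 (λ x y → x := (x :+ y) :- y) refl E-l0 E-0l ⟩
    (E-l0 + E-0l) - E-0l   ≈⟨ +-cong (expand₂-antisym (λ row → row (suc l)) (λ row → row zero) v minor minor-extensional)
                                     (-‿cong E-0l≈0) ⟩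
    0# - 0#                ≈⟨ -‿inverseʳ 0# ⟩
    0#                     ∎
    where
    E-l0 E-0l : Carrier
    E-l0 = expand₂ (λ row → row (suc l)) (λ row → row zero) v minor
    E-0l = expand₂ (λ row → row zero) (λ row → row (suc l)) v minor
    -- expanding E-0l first along column 0 leaves column expansions of minors
    E-0l≈0 : E-0l ≈ 0#
    E-0l≈0 = alt-zero {f = λ q → v q zero * columnExpansion (minorRows q) l}
      (λ q → trans (*-congˡ (columnExpansion-zero n (minorRows q) l)) (zeroʳ _))
      where
      minorRows : Fin (suc (suc n)) → Matrix (suc n) n
      minorRows q i j = v (punchIn q i) (suc j)

  identity : ∀ {n} → Matrix n n
  identity zero    zero    = 1#
  identity zero    (suc j) = 0#
  identity (suc i) zero    = 0#
  identity (suc i) (suc j) = identity i j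

  det-identity : ∀ n → det (identity {n}) ≈ 1#
  det-identity zero    = refl
  det-identity (suc n) = begin
    1# * det (identity {n}) - alt {n} (λ s → 0# * rest s)
      ≈⟨ +-cong (*-congˡ (det-identity n)) (-‿cong (alt-zero {f = λ s → 0# * rest s} (λ s → zeroˡ _))) ⟩
    1# * 1# - 0#  ≈⟨ solve 0 (con (+ 1) :* con (+ 1) :- con (+ 0) := con (+ 1)) refl ⟩
    1#            ∎
    where
    rest : Fin n → Carrier
    rest s = minor (λ i → identity (punchIn (suc s) i))

module FieldArithmetic {c ℓ} (F : FiniteField c ℓ) where

  open FiniteField F hiding (zero)
  open Geometry F using (∑; ∏; _·_; Vect)
  open IntegerCoefficients commutativeRing using (solve; _:+_; _:*_; :-_; _:-_; _:=_)
  open import Algebra.Bundles using (Semiring)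
  open import Algebra.Definitions.RawSemiring (Semiring.rawSemiring semiring) using (_^_)
  open import Algebra.Properties.Ring ring using (-0#≈0#)
  open import Data.Nat using (zero; suc)
  open import Data.Fin using (Fin; zero; suc; punchIn; inject₁; fromℕ; _≟_)
  import Data.Fin.Properties as Fin
  open import Data.Product using (proj₁; proj₂)
  open import Data.Bool using (if_then_else_)
  open import Relation.Nullary using (¬_; does)
  open import Relation.Binary.PropositionalEquality using (_≢_)
  open import Relation.Binary.Reasoning.Setoid setoid

  1≉0 : ¬ (1# ≈ 0#)
  1≉0 1≈0 = 0≉1 (sym 1≈0)

  cancelˡ : ∀ {x y} → ¬ (x ≈ 0#) → x * y ≈ 0# → y ≈ 0#
  cancelˡ {x} {y} x≉0 xy≈0 = begin
    y              ≈⟨ *-identityˡ y ⟨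
    1# * y         ≈⟨ *-congʳ x⁻¹x≈1 ⟨
    (x⁻¹ * x) * y  ≈⟨ *-assoc x⁻¹ x y ⟩
    x⁻¹ * (x * y)  ≈⟨ *-congˡ xy≈0 ⟩
    x⁻¹ * 0#       ≈⟨ zeroʳ x⁻¹ ⟩
    0#             ∎
    where
    x⁻¹ = proj₁ (inverse x x≉0)
    x⁻¹x≈1 = trans (*-comm x⁻¹ x) (proj₂ (inverse x x≉0))

  *-nonzero : ∀ {x y} → ¬ (x ≈ 0#) → ¬ (y ≈ 0#) → ¬ (x * y ≈ 0#)
  *-nonzero x≉0 y≉0 xy≈0 = y≉0 (cancelˡ x≉0 xy≈0)

  ^-nonzero : ∀ {x} n → ¬ (x ≈ 0#) → ¬ (x ^ n ≈ 0#)
  ^-nonzero zero    x≉0 = 1≉0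
  ^-nonzero (suc n) x≉0 = *-nonzero x≉0 (^-nonzero n x≉0)

  ∑-cong : ∀ {n} {f g : Fin n → Carrier} → (∀ i → f i ≈ g i) → ∑ f ≈ ∑ g
  ∑-cong {zero}  f≈g = refl
  ∑-cong {suc n} f≈g = +-cong (f≈g zero) (∑-cong (λ i → f≈g (suc i)))

  ∑-zero : ∀ {n} {f : Fin n → Carrier} → (∀ i → f i ≈ 0#) → ∑ f ≈ 0#
  ∑-zero {zero}  f≈0 = refl
  ∑-zero {suc n} f≈0 = trans (+-cong (f≈0 zero) (∑-zero (λ i → f≈0 (suc i)))) (+-identityˡ 0#)

  ∑-*ˡ : ∀ {n} x (f : Fin n → Carrier) → x * ∑ f ≈ ∑ (λ i → x * f i)
  ∑-*ˡ {zero}  x f = zeroʳ x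
  ∑-*ˡ {suc n} x f = trans (distribˡ x _ _) (+-congˡ (∑-*ˡ x (λ i → f (suc i))))

  ∑-− : ∀ {n} (f g : Fin n → Carrier) → ∑ (λ i → f i - g i) ≈ ∑ f - ∑ g
  ∑-− {zero}  f g = sym (-‿inverseʳ 0#)
  ∑-− {suc n} f g = begin
    (f zero - g zero) + ∑ (λ i → f (suc i) - g (suc i))
      ≈⟨ +-congˡ (∑-− (λ i → f (suc i)) (λ i → g (suc i))) ⟩
    (f zero - g zero) + (∑ (λ i → f (suc i)) - ∑ (λ i → g (suc i)))
      ≈⟨ solve 4 (λ a b c d → (a :- b) :+ (c :- d) := (a :+ c) :- (b :+ d)) refl (f zero) (g zero) _ _ ⟩
    ∑ f - ∑ g ∎

  ∑-neg : ∀ {n} (f : Fin n → Carrier) → - ∑ f ≈ ∑ (λ i → - f i)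
  ∑-neg {zero}  f = -0#≈0#
  ∑-neg {suc n} f = trans (solve 2 (λ a b → :- (a :+ b) := (:- a) :+ (:- b)) refl (f zero) _)
                          (+-congˡ (∑-neg (λ i → f (suc i))))

  ∑-last : ∀ {k} (f : Fin (suc k) → Carrier) → ∑ f ≈ ∑ (λ i → f (inject₁ i)) + f (fromℕ k)
  ∑-last {zero}  f = +-comm _ _
  ∑-last {suc k} f = trans (+-congˡ (∑-last (λ i → f (suc i)))) (sym (+-assoc _ _ _))

  ∏-cong : ∀ {n} {f g : Fin n → Carrier} → (∀ i → f i ≈ g i) → ∏ f ≈ ∏ g
  ∏-cong {zero}  f≈g = refl
  ∏-cong {suc n} f≈g = *-cong (f≈g zero) (∏-cong (λ i → f≈g (suc i)))

  ∏-zero : ∀ {n} (f : Fin n → Carrier) i → f i ≈ 0# → ∏ f ≈ 0#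
  ∏-zero f zero    fi≈0 = trans (*-congʳ fi≈0) (zeroˡ _)
  ∏-zero f (suc i) fi≈0 = trans (*-congˡ (∏-zero (λ j → f (suc j)) i fi≈0)) (zeroʳ _)

  ∏-nonzero : ∀ {n} (f : Fin n → Carrier) → (∀ i → ¬ (f i ≈ 0#)) → ¬ (∏ f ≈ 0#)
  ∏-nonzero {zero}  f f≉0 = 1≉0
  ∏-nonzero {suc n} f f≉0 = *-nonzero (f≉0 zero) (∏-nonzero (λ i → f (suc i)) (λ i → f≉0 (suc i)))

  ∏-scale : ∀ {n} d (f : Fin n → Carrier) → ∏ (λ i → d * f i) ≈ d ^ n * ∏ f
  ∏-scale {zero}  d f = sym (*-identityˡ 1#)
  ∏-scale {suc n} d f = trans (*-congˡ (∏-scale d (λ i → f (suc i))))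
    (solve 4 (λ d a p q → (d :* a) :* (p :* q) := (d :* p) :* (a :* q)) refl d (f zero) (d ^ n) (∏ (λ i → f (suc i))))

  ∏-skip : ∀ {n} (w : Fin (suc n)) (f : Fin (suc n) → Carrier) →
    ∏ (λ v → if does (v ≟ w) then 1# else f v) ≈ ∏ (λ v → f (punchIn w v))
  ∏-skip zero            f = *-identityˡ _
  ∏-skip {suc n} (suc w) f = *-congˡ (∏-skip w (λ v → f (suc v)))

  ∑-single : ∀ {n} (f : Fin n → Carrier) w → (∀ v → v ≢ w → f v ≈ 0#) → ∑ f ≈ f w
  ∑-single f zero    others≈0 = trans (+-congˡ (∑-zero (λ v → others≈0 (suc v) (λ ())))) (+-identityʳ _)
  ∑-single f (suc w) others≈0 = trans (+-cong (others≈0 zero (λ ()))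
    (∑-single (λ v → f (suc v)) w (λ v v≢w → others≈0 (suc v) (λ e → v≢w (Fin.suc-injective e))))) (+-identityˡ _)

  ·-zero : ∀ {k} (z : Vect k) {y : Vect k} → (∀ l → y l ≈ 0#) → z · y ≈ 0#
  ·-zero z y≈0 = ∑-zero (λ l → trans (*-congˡ (y≈0 l)) (zeroʳ _))

  ·-linear₂ : ∀ {k} (z : Vect k) α γ (y y′ : Vect k) →
    z · (λ l → α * y l - γ * y′ l) ≈ α * (z · y) - γ * (z · y′)
  ·-linear₂ z α γ y y′ = begin
    ∑ (λ l → z l * (α * y l - γ * y′ l))
      ≈⟨ ∑-cong (λ l → solve 5 (λ z α γ y y′ → z :* (α :* y :- γ :* y′) := α :* (z :* y) :- γ :* (z :* y′))
                              refl (z l) α γ (y l) (y′ l)) ⟩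
    ∑ (λ l → α * (z l * y l) - γ * (z l * y′ l))
      ≈⟨ ∑-− (λ l → α * (z l * y l)) (λ l → γ * (z l * y′ l)) ⟩
    ∑ (λ l → α * (z l * y l)) - ∑ (λ l → γ * (z l * y′ l))
      ≈⟨ +-cong (∑-*ˡ α (λ l → z l * y l)) (-‿cong (∑-*ˡ γ (λ l → z l * y′ l))) ⟨
    α * (z · y) - γ * (z · y′) ∎

  ·-linear₃ : ∀ {k} (z : Vect k) α γ δ (y y′ y″ : Vect k) →
    z · (λ l → α * y l - γ * y′ l - δ * y″ l) ≈ α * (z · y) - γ * (z · y′) - δ * (z · y″)
  ·-linear₃ z α γ δ y y′ y″ = begin
    ∑ (λ l → z l * (α * y l - γ * y′ l - δ * y″ l))
      ≈⟨ ∑-cong (λ l → solve 7 (λ z α γ δ y y′ y″ → z :* (α :* y :- γ :* y′ :- δ :* y″)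
                                                    := z :* (α :* y :- γ :* y′) :- δ :* (z :* y″))
                              refl (z l) α γ δ (y l) (y′ l) (y″ l)) ⟩
    ∑ (λ l → z l * (α * y l - γ * y′ l) - δ * (z l * y″ l))
      ≈⟨ ∑-− (λ l → z l * (α * y l - γ * y′ l)) (λ l → δ * (z l * y″ l)) ⟩
    z · (λ l → α * y l - γ * y′ l) - ∑ (λ l → δ * (z l * y″ l))
      ≈⟨ +-cong (·-linear₂ z α γ y y′) (-‿cong (sym (∑-*ˡ δ (λ l → z l * y″ l)))) ⟩
    α * (z · y) - γ * (z · y′) - δ * (z · y″) ∎


module LinearAlgebra {c ℓ} (F : FiniteField c ℓ) where

  open FiniteField F hiding (zero)
  open Geometry F using (∑; _·_; Vect; LinIndep)
  open FieldArithmetic F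
  open Determinant commutativeRing
  open IntegerCoefficients commutativeRing using (solve; con; _:*_; :-_; _:-_; _:=_)
  open import Algebra.Properties.Ring ring using (-‿involutive; -0#≈0#)
  open import Data.Integer using (+_)
  open import Level using (_⊔_)
  open import Function using (_∘_)
  open import Data.Nat as ℕ using (ℕ; zero; suc)
  import Data.Nat.Properties as ℕ
  open import Data.Fin using (Fin; zero; suc; punchIn; toℕ; inject₁; fromℕ; fromℕ<)
  import Data.Fin.Properties as Fin
  open import Data.Vec.Functional using (_∷_; insertAt; removeAt)
  open import Data.Vec.Functional.Properties using (insertAt-lookup; insertAt-punchIn)
  open import Data.Product using (Σ; _,_; _×_)
  open import Data.Sum using (inj₁; inj₂)
  open import Data.Empty using (⊥-elim)
  open import Relation.Nullary using (¬_; yes; no)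
  open import Relation.Binary.PropositionalEquality as ≡ using (_≡_)
  open import Relation.Binary.Reasoning.Setoid setoid

  ∑-alt-swap : ∀ {m n} (G : Fin m → Fin n → Carrier) → ∑ (λ l → alt (G l)) ≈ alt (λ r → ∑ (λ l → G l r))
  ∑-alt-swap {m} {zero}  G = ∑-zero {f = λ l → alt (G l)} (λ l → refl)
  ∑-alt-swap {m} {suc n} G = begin
    ∑ (λ l → G l zero - alt (λ r → G l (suc r)))
      ≈⟨ ∑-− (λ l → G l zero) (λ l → alt (λ r → G l (suc r))) ⟩
    ∑ (λ l → G l zero) - ∑ (λ l → alt (λ r → G l (suc r)))
      ≈⟨ +-congˡ (-‿cong (∑-alt-swap (λ l r → G l (suc r)))) ⟩
    alt (λ r → ∑ (λ l → G l r)) ∎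

  sign : ∀ {n} → Fin n → Carrier
  sign zero    = 1#
  sign (suc r) = - sign r

  sign-nonzero : ∀ {n} (r : Fin n) → ¬ (sign r ≈ 0#)
  sign-nonzero zero    = 1≉0
  sign-nonzero (suc r) s≈0 = sign-nonzero r (trans (sym (-‿involutive _)) (trans (-‿cong s≈0) -0#≈0#))

  alt≈∑ : ∀ {n} (f : Fin n → Carrier) → alt f ≈ ∑ (λ r → sign r * f r)
  alt≈∑ {zero}  f = refl
  alt≈∑ {suc n} f = begin
    f zero - alt (λ i → f (suc i))
      ≈⟨ +-cong (sym (*-identityˡ _)) (-‿cong (alt≈∑ (λ i → f (suc i)))) ⟩
    1# * f zero - ∑ (λ r → sign r * f (suc r))
      ≈⟨ +-congˡ (∑-neg (λ r → sign r * f (suc r))) ⟩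
    1# * f zero + ∑ (λ r → - (sign r * f (suc r)))
      ≈⟨ +-congˡ (∑-cong (λ r → solve 2 (λ a b → :- (a :* b) := (:- a) :* b) refl (sign r) (f (suc r)))) ⟩
    ∑ (λ r → sign r * f r) ∎

  -- The cofactors of k+1 rows of length k give a linear relation among
  -- the rows (this is columnExpansion-zero, column by column).
  cofactor : ∀ {k} → Matrix (suc k) k → Fin (suc k) → Carrier
  cofactor v r = sign r * det (removeAt v r)

  cofactor-relation : ∀ k (v : Matrix (suc k) k) l → ∑ (λ r → cofactor v r * v r l) ≈ 0#
  cofactor-relation k v l = begin
    ∑ (λ r → cofactor v r * v r l)
      ≈⟨ ∑-cong (λ r → solve 3 (λ s d x → (s :* d) :* x := s :* (x :* d)) refl (sign r) (det (removeAt v r)) (v r l)) ⟩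
    ∑ (λ r → sign r * (v r l * det (removeAt v r))) ≈⟨ alt≈∑ (λ r → v r l * det (removeAt v r)) ⟨
    columnExpansion v l                           ≈⟨ columnExpansion-zero k v l ⟩
    0# ∎

  punchIn-below : ∀ {n} (r : Fin (suc n)) (i : Fin n) → toℕ i ℕ.< toℕ r → punchIn r i ≡ inject₁ i
  punchIn-below (suc r) zero    _            = ≡.refl
  punchIn-below (suc r) (suc i) (ℕ.s≤s i<r)  = ≡.cong suc (punchIn-below r i i<r)

  ¬¬-∀ : ∀ {a} {n} {Q : Fin n → Set a} → (∀ i → ¬ ¬ Q i) → ¬ ¬ (∀ i → Q i)
  ¬¬-∀ {n = zero}  ¬¬Q k = k (λ ())
  ¬¬-∀ {n = suc n} ¬¬Q k =
    ¬¬Q zero (λ q₀ → ¬¬-∀ (λ i → ¬¬Q (suc i)) (λ qs → k (λ { zero → q₀ ; (suc i) → qs i })))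

  ¬¬-premise : ∀ {a b} {X : Set a} {Y : Set b} → (X → ¬ ¬ Y) → ¬ ¬ (X → Y)
  ¬¬-premise f k = k (λ x → ⊥-elim (f x (λ y → k (λ _ → y))))

  -- We show by
  -- induction on p that, not-not, some matrix with nonzero determinant
  -- agrees with b on its first p rows (for p = 0: the identity).
  module _ {k} (b : Matrix k k) (indep : LinIndep b) where

    AgreesUpTo : ℕ → Matrix k k → Set ℓ
    AgreesUpTo p g = ∀ i → toℕ i ℕ.< p → ∀ j → g i j ≈ b i j

    Completion : ℕ → Set (c ⊔ ℓ)
    Completion p = Σ (Matrix k k) λ g → AgreesUpTo p g × ¬ (det g ≈ 0#)

    module Insertion (p : ℕ) (p<k : p ℕ.< k) (g : Matrix k k) (g-agrees : AgreesUpTo p g) where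

      pₖ : Fin k
      pₖ = fromℕ< p<k

      pos : Fin (suc k)
      pos = inject₁ pₖ

      rows : Matrix (suc k) k
      rows = insertAt g pos (b pₖ)

      rows-agree : ∀ i → toℕ i ℕ.≤ p → ∀ j → rows (inject₁ i) j ≈ b i j
      rows-agree i i≤p j with ℕ.m≤n⇒m<n∨m≡n i≤p
      ... | inj₁ i<p = begin
        rows (inject₁ i) j     ≡⟨ ≡.cong (λ r → rows r j) (punchIn-below pos i i<pos) ⟨
        rows (punchIn pos i) j ≡⟨ ≡.cong (λ row → row j) (insertAt-punchIn g pos (b pₖ) i) ⟩
        g i j                  ≈⟨ g-agrees i i<p j ⟩
        b i j                  ∎
        where
        i<pos : toℕ i ℕ.< toℕ pos
        i<pos = ≡.subst (toℕ i ℕ.<_) (≡.sym (≡.trans (Fin.toℕ-inject₁ pₖ) (Fin.toℕ-fromℕ< p<k))) i<p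
      ... | inj₂ i≡p = begin
        rows (inject₁ i) j ≡⟨ ≡.cong (λ r → rows (inject₁ r) j) i≡pₖ ⟩
        rows pos j         ≡⟨ ≡.cong (λ row → row j) (insertAt-lookup g pos (b pₖ)) ⟩
        b pₖ j             ≡⟨ ≡.cong (λ r → b r j) (≡.sym i≡pₖ) ⟩
        b i j              ∎
        where
        i≡pₖ : i ≡ pₖ
        i≡pₖ = Fin.toℕ-injective (≡.trans i≡p (≡.sym (Fin.toℕ-fromℕ< p<k)))

      det-without-pos : det (removeAt rows pos) ≈ det g
      det-without-pos = det-cong (λ i j → reflexive (≡.cong (λ row → row j) (insertAt-punchIn g pos (b pₖ) i)))

      without-high-agrees : ∀ r → p ℕ.< toℕ r → AgreesUpTo (suc p) (removeAt rows r)
      without-high-agrees r p<r i (ℕ.s≤s i≤p) j =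
        trans (reflexive (≡.cong (λ q → rows q j) (punchIn-below r i (ℕ.≤-<-trans i≤p p<r)))) (rows-agree i i≤p j)

    -- If no completion for p+1 rows exists, the minors of the inserted
    -- matrix at rows r > p all vanish, so the cofactor relation is a
    -- dependency among b_0, …, b_p whose coefficient of b_p is ±det g ≉ 0.
    completion-step : ∀ p → p ℕ.< k → Completion p → ¬ ¬ Completion (suc p)
    completion-step p p<k (g , g-agrees , det-g≉0) no-completion =
      ¬¬-∀ (λ r → ¬¬-premise (high-minor-vanishes r)) no-dependency
      where
      open Insertion p p<k g g-agrees

      high-minor-vanishes : ∀ r → p ℕ.< toℕ r → ¬ ¬ (det (removeAt rows r) ≈ 0#)
      high-minor-vanishes r p<r det≉0 = no-completion (removeAt rows r , without-high-agrees r p<r , det≉0)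

      no-dependency : ¬ (∀ r → p ℕ.< toℕ r → det (removeAt rows r) ≈ 0#)
      no-dependency vanish =
        *-nonzero (sign-nonzero pos) (det-g≉0 ∘ trans (sym det-without-pos)) (indep coef relation pₖ)
        where
        coef : Fin k → Carrier
        coef i = cofactor rows (inject₁ i)
        high-zero : ∀ r → p ℕ.< toℕ r → cofactor rows r ≈ 0#
        high-zero r p<r = trans (*-congˡ (vanish r p<r)) (zeroʳ _)
        term : ∀ l i → cofactor rows (inject₁ i) * rows (inject₁ i) l ≈ coef i * b i l
        term l i with toℕ i ℕ.≤? p
        ... | yes i≤p = *-congˡ (rows-agree i i≤p l)
        ... | no  i≰p = trans (trans (*-congʳ coef≈0) (zeroˡ _)) (sym (trans (*-congʳ coef≈0) (zeroˡ _)))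
          where
          coef≈0 : coef i ≈ 0#
          coef≈0 = high-zero (inject₁ i) (≡.subst (p ℕ.<_) (≡.sym (Fin.toℕ-inject₁ i)) (ℕ.≰⇒> i≰p))
        last-zero : cofactor rows (fromℕ k) ≈ 0#
        last-zero = high-zero (fromℕ k) (≡.subst (p ℕ.<_) (≡.sym (Fin.toℕ-fromℕ k)) p<k)
        relation : ∀ l → ∑ (λ i → coef i * b i l) ≈ 0#
        relation l = begin
          ∑ (λ i → coef i * b i l)                                    ≈⟨ ∑-cong (term l) ⟨
          ∑ (λ i → cofactor rows (inject₁ i) * rows (inject₁ i) l)    ≈⟨ +-identityʳ _ ⟨
          ∑ (λ i → cofactor rows (inject₁ i) * rows (inject₁ i) l) + 0#
            ≈⟨ +-congˡ (trans (*-congʳ last-zero) (zeroˡ _)) ⟨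
          ∑ (λ i → cofactor rows (inject₁ i) * rows (inject₁ i) l) + cofactor rows (fromℕ k) * rows (fromℕ k) l
            ≈⟨ ∑-last (λ r → cofactor rows r * rows r l) ⟨
          ∑ (λ r → cofactor rows r * rows r l)                        ≈⟨ cofactor-relation k rows l ⟩
          0#                                                          ∎

    completion : ∀ p → p ℕ.≤ k → ¬ ¬ Completion p
    completion zero    _   none = none (identity , (λ i ()) , λ det≈0 → 1≉0 (trans (sym (det-identity k)) det≈0))
    completion (suc p) p<k none = completion p (ℕ.<⇒≤ p<k) (λ c → completion-step p p<k c none)

    independent⇒det≉0 : ¬ (det b ≈ 0#)
    independent⇒det≉0 det≈0 = completion k ℕ.≤-refl
      (λ { (g , g-agrees , det-g≉0) → det-g≉0 (trans (det-cong (λ i j → g-agrees i (Fin.toℕ<n i) j)) det≈0) })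

  identity-· : ∀ {n} (j : Fin n) (y : Vect n) → identity j · y ≈ y j
  identity-· {suc n} zero y = begin
    1# * y zero + ∑ (λ l → 0# * y (suc l))
      ≈⟨ +-cong (*-identityˡ _) (∑-zero {f = λ l → 0# * y (suc l)} (λ l → zeroˡ _)) ⟩
    y zero + 0# ≈⟨ +-identityʳ _ ⟩
    y zero      ∎
  identity-· {suc n} (suc j) y = begin
    0# * y zero + ∑ (λ l → identity j l * y (suc l)) ≈⟨ +-cong (zeroˡ _) (identity-· j (λ l → y (suc l))) ⟩
    0# + y (suc j)                                   ≈⟨ +-identityˡ _ ⟩
    y (suc j)                                        ∎

  -- Sum the column expansions of the
  -- rows (e_j; b), weighted by y: this gives det b * y_j, and zero.
  det-*-orthogonal : ∀ {k} (b : Matrix k k) (y : Vect k) → (∀ r → b r · y ≈ 0#) → ∀ j → det b * y j ≈ 0#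
  det-*-orthogonal {k} b y b⊥y j = sym (begin
    0#
      ≈⟨ ∑-zero (λ l → trans (*-congˡ (columnExpansion-zero k v l)) (zeroʳ _)) ⟨
    ∑ (λ l → y l * columnExpansion v l)
      ≈⟨ ∑-cong (λ l → trans (alt-*ˡ (y l) (λ r → v r l * d r)) (alt-cong (λ r →
           solve 3 (λ a b c → a :* (b :* c) := c :* (b :* a)) refl (y l) (v r l) (d r)))) ⟩
    ∑ (λ l → alt (λ r → d r * (v r l * y l)))
      ≈⟨ ∑-alt-swap (λ l r → d r * (v r l * y l)) ⟩
    alt (λ r → ∑ (λ l → d r * (v r l * y l)))
      ≈⟨ alt-cong (λ r → sym (∑-*ˡ (d r) (λ l → v r l * y l))) ⟩
    d zero * (identity j · y) - alt (λ r → d (suc r) * (b r · y))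
      ≈⟨ +-cong (*-congˡ (identity-· j y))
                (-‿cong (alt-zero {f = λ r → d (suc r) * (b r · y)} (λ r → trans (*-congˡ (b⊥y r)) (zeroʳ _)))) ⟩
    det b * y j - 0#
      ≈⟨ solve 1 (λ x → x :- con (+ 0) := x) refl (det b * y j) ⟩
    det b * y j ∎)
    where
    v : Matrix (suc k) k
    v = identity j ∷ b
    d : Fin (suc k) → Carrier
    d r = det (removeAt v r)

  orthogonal-to-independent : ∀ {k} (b : Matrix k k) → LinIndep b →
    (y : Vect k) → (∀ r → b r · y ≈ 0#) → ∀ j → y j ≈ 0#
  orthogonal-to-independent b indep y b⊥y j = cancelˡ (independent⇒det≉0 b indep) (det-*-orthogonal b y b⊥y j)

module BinaryForms {c ℓ} (F : FiniteField c ℓ) where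

  open FiniteField F hiding (zero)
  open Geometry F using (∑; ∏)
  open FieldArithmetic F using (cancelˡ; ^-nonzero)
  open IntegerCoefficients commutativeRing using (solve; con; _:+_; _:*_; _:-_; _:=_)
  open import Algebra.Bundles using (Semiring)
  open import Algebra.Definitions.RawSemiring (Semiring.rawSemiring semiring) using (_^_)
  open import Data.Integer using (+_)
  open import Data.Nat using (ℕ; zero; suc)
  open import Data.Fin using (Fin; zero; suc)
  import Data.Fin.Properties as Fin
  open import Data.Product using (Σ; _,_; proj₁; proj₂; _×_)
  open import Level using (_⊔_)
  open import Relation.Nullary using (¬_)
  open import Relation.Binary.PropositionalEquality using (_≢_)
  open import Relation.Binary.Reasoning.Setoid setoid

  Fun₂ : Set c
  Fun₂ = Carrier → Carrier → Carrier

  IsForm : ℕ → Fun₂ → Set (c ⊔ ℓ)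
  IsForm zero    H = Σ Carrier λ c₀ → ∀ σ τ → H σ τ ≈ c₀
  IsForm (suc d) H = Σ Carrier λ c₀ → Σ Fun₂ λ K →
                     IsForm d K × (∀ σ τ → H σ τ ≈ c₀ * σ ^ suc d + τ * K σ τ)

  zero-form : ∀ d → IsForm d (λ _ _ → 0#)
  zero-form zero    = 0# , λ _ _ → refl
  zero-form (suc d) = 0# , (λ _ _ → 0#) , zero-form d ,
    λ σ τ → solve 2 (λ x y → con (+ 0) := con (+ 0) :* x :+ y :* con (+ 0)) refl (σ ^ suc d) τ

  +-form : ∀ d {H H′ : Fun₂} → IsForm d H → IsForm d H′ → IsForm d (λ σ τ → H σ τ + H′ σ τ)
  +-form zero    (c₀ , H≈) (c₁ , H′≈) = c₀ + c₁ , λ σ τ → +-cong (H≈ σ τ) (H′≈ σ τ)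
  +-form (suc d) (c₀ , K , K-form , H≈) (c₁ , K′ , K′-form , H′≈) =
    c₀ + c₁ , (λ σ τ → K σ τ + K′ σ τ) , +-form d K-form K′-form ,
    λ σ τ → trans (+-cong (H≈ σ τ) (H′≈ σ τ))
      (solve 6 (λ a b t k k′ x → (a :* x :+ t :* k) :+ (b :* x :+ t :* k′) := (a :+ b) :* x :+ t :* (k :+ k′))
             refl c₀ c₁ τ (K σ τ) (K′ σ τ) (σ ^ suc d))

  ∑-form : ∀ d {m} (H : Fin m → Fun₂) → (∀ w → IsForm d (H w)) → IsForm d (λ σ τ → ∑ (λ w → H w σ τ))
  ∑-form d {zero}  H forms = zero-form d
  ∑-form d {suc m} H forms = +-form d (forms zero) (∑-form d (λ w → H (suc w)) (λ w → forms (suc w)))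

  scale-form : ∀ d x {H : Fun₂} → IsForm d H → IsForm d (λ σ τ → x * H σ τ)
  scale-form zero    x (c₀ , H≈) = x * c₀ , λ σ τ → *-congˡ (H≈ σ τ)
  scale-form (suc d) x (c₀ , K , K-form , H≈) = x * c₀ , (λ σ τ → x * K σ τ) , scale-form d x K-form ,
    λ σ τ → trans (*-congˡ (H≈ σ τ))
      (solve 5 (λ x c p t k → x :* (c :* p :+ t :* k) := x :* c :* p :+ t :* (x :* k)) refl x c₀ (σ ^ suc d) τ (K σ τ))

  lead-form : ∀ d x {H : Fun₂} → IsForm (suc d) H → IsForm (suc d) (λ σ τ → x * σ ^ suc d + H σ τ)
  lead-form d x (c₀ , K , K-form , H≈) = x + c₀ , K , K-form ,
    λ σ τ → trans (+-congˡ (H≈ σ τ))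
      (solve 5 (λ x c p t k → x :* p :+ (c :* p :+ t :* k) := (x :+ c) :* p :+ t :* k) refl x c₀ (σ ^ suc d) τ (K σ τ))

  linear-*-form : ∀ d p q {H : Fun₂} → IsForm d H → IsForm (suc d) (λ σ τ → (p * σ + q * τ) * H σ τ)
  linear-*-form zero p q (c₀ , H≈) = p * c₀ , (λ _ _ → q * c₀) , (q * c₀ , λ _ _ → refl) ,
    λ σ τ → trans (*-congˡ (H≈ σ τ))
      (solve 5 (λ p q c s t → (p :* s :+ q :* t) :* c := p :* c :* (s :* con (+ 1)) :+ t :* (q :* c)) refl p q c₀ σ τ)
  linear-*-form (suc d) p q (c₀ , K , K-form , H≈) = p * c₀ , K′ , K′-form ,
    λ σ τ → trans (*-congˡ (H≈ σ τ))
      (solve 7 (λ p q c s t x k → (p :* s :+ q :* t) :* (c :* x :+ t :* k)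
                                  := p :* c :* (s :* x) :+ t :* (q :* c :* x :+ (p :* s :+ q :* t) :* k))
             refl p q c₀ σ τ (σ ^ suc d) (K σ τ))
    where
    K′ : Fun₂
    K′ σ τ = q * c₀ * σ ^ suc d + (p * σ + q * τ) * K σ τ
    K′-form : IsForm (suc d) K′
    K′-form = lead-form d (q * c₀) (linear-*-form d p q K-form)

  ∏-linear-form : ∀ {m} (p q : Fin m → Carrier) → IsForm m (λ σ τ → ∏ (λ i → p i * σ + q i * τ))
  ∏-linear-form {zero}  p q = 1# , λ _ _ → refl
  ∏-linear-form {suc m} p q = linear-*-form m (p zero) (q zero) (∏-linear-form (λ i → p (suc i)) (λ i → q (suc i)))

  through : Carrier → Carrier → Fun₂
  through s t σ τ = σ * t - τ * s

  -- one step of division by (σ t₀ - τ s₀) when (s₀, t₀) is a root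
  -- with t₀ ≉ 0: the quotient's leading coefficient is c₀ / t₀
  split-root : ∀ d {H : Fun₂} c₀ (K : Fun₂) → (∀ σ τ → H σ τ ≈ c₀ * σ ^ suc d + τ * K σ τ) →
    ∀ s₀ t₀ → ¬ (t₀ ≈ 0#) → H s₀ t₀ ≈ 0# →
    Σ Carrier λ u → (∀ σ τ → H σ τ ≈ through s₀ t₀ σ τ * (u * σ ^ d) + τ * (u * s₀ * σ ^ d + K σ τ))
                  × (u * s₀ * s₀ ^ d + K s₀ t₀ ≈ 0#)
  split-root d {H} c₀ K H≈ s₀ t₀ t₀≉0 root = u , H≈split , rest-root
    where
    t₀⁻¹ = proj₁ (inverse t₀ t₀≉0)
    u = c₀ * t₀⁻¹
    H≈split : ∀ σ τ → H σ τ ≈ through s₀ t₀ σ τ * (u * σ ^ d) + τ * (u * s₀ * σ ^ d + K σ τ)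
    H≈split σ τ = begin
      H σ τ                              ≈⟨ H≈ σ τ ⟩
      c₀ * (σ * σ ^ d) + τ * K σ τ
        ≈⟨ +-congʳ (*-congʳ (trans (*-congˡ (proj₂ (inverse t₀ t₀≉0))) (*-identityʳ c₀))) ⟨
      (c₀ * (t₀ * t₀⁻¹)) * (σ * σ ^ d) + τ * K σ τ
        ≈⟨ solve 8 (λ c t i σ τ s x k → (c :* (t :* i)) :* (σ :* x) :+ τ :* k
                                         := (σ :* t :- τ :* s) :* (c :* i :* x) :+ τ :* (c :* i :* s :* x :+ k))
                   refl c₀ t₀ t₀⁻¹ σ τ s₀ (σ ^ d) (K σ τ) ⟩
      through s₀ t₀ σ τ * (u * σ ^ d) + τ * (u * s₀ * σ ^ d + K σ τ) ∎
    rest-root : u * s₀ * s₀ ^ d + K s₀ t₀ ≈ 0#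
    rest-root = cancelˡ t₀≉0 (begin
      t₀ * (u * s₀ * s₀ ^ d + K s₀ t₀)
        ≈⟨ solve 4 (λ s t y k → t :* k := (s :* t :- t :* s) :* y :+ t :* k) refl s₀ t₀ (u * s₀ ^ d) _ ⟩
      through s₀ t₀ s₀ t₀ * (u * s₀ ^ d) + t₀ * (u * s₀ * s₀ ^ d + K s₀ t₀) ≈⟨ H≈split s₀ t₀ ⟨
      H s₀ t₀                                                                ≈⟨ root ⟩
      0# ∎)

  factor-root : ∀ d {H : Fun₂} → IsForm (suc d) H → ∀ s₀ t₀ → ¬ (t₀ ≈ 0#) → H s₀ t₀ ≈ 0# →
    Σ Fun₂ λ Q → IsForm d Q × (∀ σ τ → H σ τ ≈ through s₀ t₀ σ τ * Q σ τ)
  factor-root zero {H} (c₀ , K , (k₀ , K≈) , H≈) s₀ t₀ t₀≉0 root =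
    (λ _ _ → u * 1#) , (u * 1# , λ _ _ → refl) , H≈factored
    where
    split = split-root zero c₀ K H≈ s₀ t₀ t₀≉0 root
    u = proj₁ split
    -- the degree-0 remainder is a constant with a root, hence zero
    rest-zero : ∀ σ τ → u * s₀ * 1# + K σ τ ≈ 0#
    rest-zero σ τ = trans (+-congˡ (trans (K≈ σ τ) (sym (K≈ s₀ t₀)))) (proj₂ (proj₂ split))
    H≈factored : ∀ σ τ → H σ τ ≈ through s₀ t₀ σ τ * (u * 1#)
    H≈factored σ τ = begin
      H σ τ                                                    ≈⟨ proj₁ (proj₂ split) σ τ ⟩
      through s₀ t₀ σ τ * (u * 1#) + τ * (u * s₀ * 1# + K σ τ)
        ≈⟨ +-congˡ (trans (*-congˡ (rest-zero σ τ)) (zeroʳ τ)) ⟩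
      through s₀ t₀ σ τ * (u * 1#) + 0#                        ≈⟨ +-identityʳ _ ⟩
      through s₀ t₀ σ τ * (u * 1#)                             ∎
  factor-root (suc d) {H} (c₀ , K , K-form , H≈) s₀ t₀ t₀≉0 root =
    (λ σ τ → u * σ ^ suc d + τ * Q σ τ) , (u , Q , proj₁ (proj₂ rest) , λ σ τ → refl) , H≈factored
    where
    split = split-root (suc d) c₀ K H≈ s₀ t₀ t₀≉0 root
    u = proj₁ split
    -- the remainder is a form of degree d+1 with the same root
    rest = factor-root d (lead-form d (u * s₀) K-form) s₀ t₀ t₀≉0 (proj₂ (proj₂ split))
    Q : Fun₂
    Q = proj₁ rest
    L = through s₀ t₀
    H≈factored : ∀ σ τ → H σ τ ≈ L σ τ * (u * σ ^ suc d + τ * Q σ τ)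
    H≈factored σ τ = begin
      H σ τ                                                       ≈⟨ proj₁ (proj₂ split) σ τ ⟩
      L σ τ * (u * σ ^ suc d) + τ * (u * s₀ * σ ^ suc d + K σ τ)
        ≈⟨ +-congˡ (*-congˡ (proj₂ (proj₂ rest) σ τ)) ⟩
      L σ τ * (u * σ ^ suc d) + τ * (L σ τ * Q σ τ)
        ≈⟨ solve 4 (λ l x τ q → l :* x :+ τ :* (l :* q) := l :* (x :+ τ :* q))
                   refl (L σ τ) (u * σ ^ suc d) τ (Q σ τ) ⟩
      L σ τ * (u * σ ^ suc d + τ * Q σ τ) ∎

  root-bound : ∀ d {H : Fun₂} → IsForm d H → (s t : Fin (suc d) → Carrier) → (∀ i → ¬ (t i ≈ 0#)) →
    (∀ i j → i ≢ j → ¬ (through (s j) (t j) (s i) (t i) ≈ 0#)) →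
    (∀ i → H (s i) (t i) ≈ 0#) → ∀ σ τ → H σ τ ≈ 0#
  root-bound zero (c₀ , H≈) s t t≉0 apart roots σ τ = trans (H≈ σ τ) (trans (sym (H≈ (s zero) (t zero))) (roots zero))
  root-bound (suc d) H-form s t t≉0 apart roots σ τ =
    trans (proj₂ (proj₂ factored) σ τ) (trans (*-congˡ (Q-zero σ τ)) (zeroʳ _))
    where
    factored = factor-root d H-form (s zero) (t zero) (t≉0 zero) (roots zero)
    Q = proj₁ factored
    -- the other roots are roots of the quotient, since they are off the removed line
    Q-roots : ∀ i → Q (s (suc i)) (t (suc i)) ≈ 0#
    Q-roots i = cancelˡ (apart (suc i) zero (λ ()))
      (trans (sym (proj₂ (proj₂ factored) (s (suc i)) (t (suc i)))) (roots (suc i)))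
    Q-zero : ∀ σ τ → Q σ τ ≈ 0#
    Q-zero = root-bound d (proj₁ (proj₂ factored)) (λ i → s (suc i)) (λ i → t (suc i)) (λ i → t≉0 (suc i))
               (λ i j i≢j → apart (suc i) (suc j) (λ e → i≢j (Fin.suc-injective e))) Q-roots

  root-bound-∞ : ∀ d {H : Fun₂} → IsForm (suc d) H → ∀ s₀ t₀ → ¬ (s₀ ≈ 0#) → t₀ ≈ 0# → H s₀ t₀ ≈ 0# →
    (s t : Fin (suc d) → Carrier) → (∀ i → ¬ (t i ≈ 0#)) →
    (∀ i j → i ≢ j → ¬ (through (s j) (t j) (s i) (t i) ≈ 0#)) →
    (∀ i → H (s i) (t i) ≈ 0#) → ∀ σ τ → H σ τ ≈ 0#
  root-bound-∞ d {H} (c₀ , K , K-form , H≈) s₀ t₀ s₀≉0 t₀≈0 root∞ s t t≉0 apart roots σ τ = begin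
    H σ τ                      ≈⟨ H≈ σ τ ⟩
    c₀ * σ ^ suc d + τ * K σ τ ≈⟨ +-cong (trans (*-congʳ c₀≈0) (zeroˡ _))
                                        (trans (*-congˡ (K-zero σ τ)) (zeroʳ τ)) ⟩
    0# + 0#                    ≈⟨ +-identityʳ 0# ⟩
    0#                         ∎
    where
    -- at infinity only the leading term survives
    c₀≈0 : c₀ ≈ 0#
    c₀≈0 = cancelˡ (^-nonzero (suc d) s₀≉0) (begin
      s₀ ^ suc d * c₀                 ≈⟨ *-comm _ _ ⟩
      c₀ * s₀ ^ suc d                 ≈⟨ +-identityʳ _ ⟨
      c₀ * s₀ ^ suc d + 0#            ≈⟨ +-congˡ (trans (*-congʳ t₀≈0) (zeroˡ _)) ⟨
      c₀ * s₀ ^ suc d + t₀ * K s₀ t₀  ≈⟨ H≈ s₀ t₀ ⟨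
      H s₀ t₀                         ≈⟨ root∞ ⟩
      0#                              ∎)
    K-roots : ∀ i → K (s i) (t i) ≈ 0#
    K-roots i = cancelˡ (t≉0 i) (begin
      t i * K (s i) (t i)                         ≈⟨ +-identityˡ _ ⟨
      0# + t i * K (s i) (t i)                    ≈⟨ +-congʳ (trans (*-congʳ c₀≈0) (zeroˡ _)) ⟨
      c₀ * s i ^ suc d + t i * K (s i) (t i)      ≈⟨ H≈ (s i) (t i) ⟨
      H (s i) (t i)                               ≈⟨ roots i ⟩
      0#                                          ∎)
    K-zero : ∀ σ τ → K σ τ ≈ 0#
    K-zero = root-bound d K-form s t t≉0 apart K-roots

-- The configuration: an arc P in F^k
-- (k = m + 2), indices a (|A| = k-2) for the line A of the dual space,
-- indices u for U (|U| = d+2 ≥ 2) disjoint from a, and d+2 pairwise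
-- non-proportional nonzero vectors x_i on the line A (i.e. orthogonal
-- to all P(a l)).
module ArcConfiguration {c ℓ} (F : FiniteField c ℓ) where

  open FiniteField F hiding (zero)
  open Geometry F using (∑; ∏; _·_; Vect; IsArc; ψ)
  open FieldArithmetic F
  open LinearAlgebra F using (orthogonal-to-independent)
  open BinaryForms F
  open IntegerCoefficients commutativeRing using (solve; con; _:+_; _:*_; :-_; _:-_; _:=_)
  open import Algebra.Bundles using (Semiring)
  open import Algebra.Definitions.RawSemiring (Semiring.rawSemiring semiring) using (_^_)
  open import Data.Integer using (+_)
  open import Data.Nat using (ℕ; zero; suc)
  open import Data.Fin using (Fin; zero; suc; punchIn; punchOut)
  import Data.Fin.Properties as Fin
  open import Data.Product using (Σ; _,_; proj₁; proj₂)
  open import Data.Empty using (⊥-elim)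
  open import Relation.Nullary using (¬_)
  open import Relation.Binary.PropositionalEquality as ≡ using (_≡_; _≢_)
  open import Relation.Binary.Reasoning.Setoid setoid

  ψ-single : ∀ {k} (lam : Fin 1 → Carrier) (U : Fin 1 → Vect k) X → ψ lam U X ≈ lam zero
  ψ-single lam U X = solve 1 (λ l → l :* (con (+ 1) :* con (+ 1)) :+ con (+ 0) := l) refl (lam zero)

  module _ (m d N : ℕ) (P : Fin N → Vect (suc (suc m))) (arc : IsArc P)
    (a : Fin m → Fin N) (a-injective : ∀ i j → a i ≡ a j → i ≡ j)
    (u : Fin (suc (suc d)) → Fin N) (u-injective : ∀ i j → u i ≡ u j → i ≡ j)
    (a≢u : ∀ i j → a i ≢ u j) where

    OnLine : Vect (suc (suc m)) → Set ℓ
    OnLine y = ∀ l → P (a l) · y ≈ 0#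

    form : Fin (suc (suc d)) → Vect (suc (suc m)) → Carrier
    form v y = P (u v) · y

    -- two elements of U together with A: k distinct points of the arc
    frame : Fin (suc (suc d)) → Fin (suc (suc d)) → Fin (suc (suc m)) → Fin N
    frame v w zero          = u v
    frame v w (suc zero)    = u w
    frame v w (suc (suc l)) = a l

    frame-injective : ∀ {v w} → v ≢ w → ∀ i j → frame v w i ≡ frame v w j → i ≡ j
    frame-injective v≢w zero          zero           e = ≡.refl
    frame-injective v≢w zero          (suc zero)     e = ⊥-elim (v≢w (u-injective _ _ e))
    frame-injective v≢w zero          (suc (suc l))  e = ⊥-elim (a≢u l _ (≡.sym e))
    frame-injective v≢w (suc zero)    zero           e = ⊥-elim (v≢w (u-injective _ _ (≡.sym e)))
    frame-injective v≢w (suc zero)    (suc zero)     e = ≡.refl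
    frame-injective v≢w (suc zero)    (suc (suc l))  e = ⊥-elim (a≢u l _ (≡.sym e))
    frame-injective v≢w (suc (suc l)) zero           e = ⊥-elim (a≢u l _ e)
    frame-injective v≢w (suc (suc l)) (suc zero)     e = ⊥-elim (a≢u l _ e)
    frame-injective v≢w (suc (suc l)) (suc (suc l′)) e = ≡.cong (λ i → suc (suc i)) (a-injective l l′ e)

    -- a point of the line A on which two distinct forms of U vanish is zero
    -- (it is orthogonal to the k independent vectors of a frame)
    on-line-zero : ∀ {v w} → v ≢ w → (y : Vect (suc (suc m))) → OnLine y → form v y ≈ 0# → form w y ≈ 0# →
                   ∀ j → y j ≈ 0#
    on-line-zero {v} {w} v≢w y y-on-line v-y≈0 w-y≈0 =
      orthogonal-to-independent (λ i → P (frame v w i)) (arc (frame v w) (frame-injective v≢w)) y orthogonal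
      where
      orthogonal : ∀ r → P (frame v w r) · y ≈ 0#
      orthogonal zero          = v-y≈0
      orthogonal (suc zero)    = w-y≈0
      orthogonal (suc (suc l)) = y-on-line l

    module _ (x : Fin (suc (suc d)) → Vect (suc (suc m)))
      (x≉0 : ∀ i → ¬ (∀ j → x i j ≈ 0#))
      (x-on-line : ∀ i → OnLine (x i))
      (x-distinct : ∀ i j → i ≢ j → ¬ Σ Carrier (λ t → ∀ l → x i l ≈ t * x j l)) where

      bracket : Fin (suc (suc d)) → Fin (suc (suc d)) → Fin (suc (suc d)) → Fin (suc (suc d)) → Carrier
      bracket v w i j = form v (x i) * form w (x j) - form v (x j) * form w (x i)

      combination-on-line : ∀ α γ i j → OnLine (λ l → α * x i l - γ * x j l)
      combination-on-line α γ i j l = begin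
        P (a l) · (λ l → α * x i l - γ * x j l) ≈⟨ ·-linear₂ (P (a l)) α γ (x i) (x j) ⟩
        α * (P (a l) · x i) - γ * (P (a l) · x j) ≈⟨ +-cong (trans (*-congˡ (x-on-line i l)) (zeroʳ α))
                                                            (-‿cong (trans (*-congˡ (x-on-line j l)) (zeroʳ γ))) ⟩
        0# - 0#                                   ≈⟨ -‿inverseʳ 0# ⟩
        0#                                        ∎

      proportional⇒zero : ∀ {i j} → i ≢ j → ∀ α γ → (∀ l → α * x i l ≈ γ * x j l) → ¬ ¬ (α ≈ 0#)
      proportional⇒zero {i} {j} i≢j α γ αxᵢ≈γxⱼ α≉0 = x-distinct i j i≢j (α⁻¹ * γ , λ l → begin
        x i l               ≈⟨ *-identityˡ _ ⟨
        1# * x i l          ≈⟨ *-congʳ α⁻¹α≈1 ⟨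
        (α⁻¹ * α) * x i l   ≈⟨ *-assoc _ _ _ ⟩
        α⁻¹ * (α * x i l)   ≈⟨ *-congˡ (αxᵢ≈γxⱼ l) ⟩
        α⁻¹ * (γ * x j l)   ≈⟨ *-assoc _ _ _ ⟨
        (α⁻¹ * γ) * x j l   ∎)
        where
        α⁻¹ = proj₁ (inverse α α≉0)
        α⁻¹α≈1 = trans (*-comm _ _) (proj₂ (inverse α α≉0))

      killed⇒proportional : ∀ {v w} → v ≢ w → ∀ α γ i j →
        α * form v (x i) - γ * form v (x j) ≈ 0# → α * form w (x i) - γ * form w (x j) ≈ 0# →
        ∀ l → α * x i l ≈ γ * x j l
      killed⇒proportional {v} {w} v≢w α γ i j v-kills w-kills l = begin
        α * x i l                            ≈⟨ solve 2 (λ p q → p := (p :- q) :+ q) refl (α * x i l) (γ * x j l) ⟩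
        (α * x i l - γ * x j l) + γ * x j l  ≈⟨ +-congʳ (combination≈0 l) ⟩
        0# + γ * x j l                       ≈⟨ +-identityˡ _ ⟩
        γ * x j l                            ∎
        where
        combination≈0 : ∀ l → α * x i l - γ * x j l ≈ 0#
        combination≈0 = on-line-zero v≢w (λ l → α * x i l - γ * x j l) (combination-on-line α γ i j)
          (trans (·-linear₂ (P (u v)) α γ (x i) (x j)) v-kills)
          (trans (·-linear₂ (P (u w)) α γ (x i) (x j)) w-kills)

      -- distinct forms of U give independent coordinates on the line:
      -- their 2×2 minor at two distinct points never vanishes.  Otherwise
      -- vⱼ x_i - vᵢ x_j and wⱼ x_i - wᵢ x_j are killed by both forms, so
      -- vⱼ = wⱼ = 0 and x_j, killed by both forms, would be zero.
      bracket-nonzero : ∀ v w i j → v ≢ w → i ≢ j → ¬ (bracket v w i j ≈ 0#)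
      bracket-nonzero v w i j v≢w i≢j bracket≈0 =
        vⱼ-zero (λ vⱼ≈0 → wⱼ-zero (λ wⱼ≈0 → x≉0 j (on-line-zero v≢w (x j) (x-on-line j) vⱼ≈0 wⱼ≈0)))
        where
        vᵢ vⱼ wᵢ wⱼ : Carrier
        vᵢ = form v (x i)
        vⱼ = form v (x j)
        wᵢ = form w (x i)
        wⱼ = form w (x j)
        vⱼ-zero : ¬ ¬ (vⱼ ≈ 0#)
        vⱼ-zero = proportional⇒zero i≢j vⱼ vᵢ (killed⇒proportional v≢w vⱼ vᵢ i j
          (solve 2 (λ a b → a :* b :- b :* a := con (+ 0)) refl vⱼ vᵢ)
          (trans (solve 4 (λ si sj ti tj → sj :* ti :- si :* tj := con (+ 0) :- (si :* tj :- sj :* ti)) refl vᵢ vⱼ wᵢ wⱼ)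
                 (trans (+-congˡ (-‿cong bracket≈0)) (-‿inverseʳ 0#))))
        wⱼ-zero : ¬ ¬ (wⱼ ≈ 0#)
        wⱼ-zero = proportional⇒zero i≢j wⱼ wᵢ (killed⇒proportional v≢w wⱼ wᵢ i j
          (trans (solve 4 (λ si sj ti tj → tj :* si :- ti :* sj := si :* tj :- sj :* ti) refl vᵢ vⱼ wᵢ wⱼ) bracket≈0)
          (solve 2 (λ a b → a :* b :- b :* a := con (+ 0)) refl wⱼ wᵢ))

      -- The first two forms of U serve as coordinates on the line.  A point
      -- x_i has coordinates (σ_i, τ_i) w.r.t. the basis x_{o₀}, x_{o₁},
      -- scaled by Δ:  Δ x_i = σ_i x_{o₀} + τ_i x_{o₁}  (Cramer's rule).
      o₀ o₁ : Fin (suc (suc d))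
      o₀ = zero
      o₁ = suc zero

      Δ : Carrier
      Δ = bracket o₀ o₁ o₀ o₁

      Δ≉0 : ¬ (Δ ≈ 0#)
      Δ≉0 = bracket-nonzero o₀ o₁ o₀ o₁ (λ ()) (λ ())

      σ τ : Fin (suc (suc d)) → Carrier
      σ i = bracket o₀ o₁ i o₁
      τ i = bracket o₀ o₁ o₀ i

      f₀ f₁ : Vect (suc (suc m)) → Carrier
      f₀ = form o₀
      f₁ = form o₁

      coordinates : ∀ i v → Δ * form v (x i) ≈ σ i * form v (x o₀) + τ i * form v (x o₁)
      coordinates i v = begin
        Δ * form v (x i)
          ≈⟨ solve 3 (λ p s t → p := (p :- s :- t) :+ (s :+ t)) refl
                     (Δ * form v (x i)) (σ i * form v (x o₀)) (τ i * form v (x o₁)) ⟩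
        (Δ * form v (x i) - σ i * form v (x o₀) - τ i * form v (x o₁)) + (σ i * form v (x o₀) + τ i * form v (x o₁))
          ≈⟨ +-congʳ (trans (sym (linear (P (u v)))) (·-zero (P (u v)) y≈0)) ⟩
        0# + (σ i * form v (x o₀) + τ i * form v (x o₁))
          ≈⟨ +-identityˡ _ ⟩
        σ i * form v (x o₀) + τ i * form v (x o₁) ∎
        where
        -- y = Δ x_i - σ_i x_{o₀} - τ_i x_{o₁} lies on the line and is
        -- killed by both coordinate forms, hence zero
        y : Vect (suc (suc m))
        y l = Δ * x i l - σ i * x o₀ l - τ i * x o₁ l
        linear : ∀ z → z · y ≈ Δ * (z · x i) - σ i * (z · x o₀) - τ i * (z · x o₁)
        linear z = ·-linear₃ z Δ (σ i) (τ i) (x i) (x o₀) (x o₁)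
        y-on-line : OnLine y
        y-on-line l = trans (linear (P (a l))) (begin
          Δ * (P (a l) · x i) - σ i * (P (a l) · x o₀) - τ i * (P (a l) · x o₁)
            ≈⟨ +-cong (+-cong (*-congˡ (x-on-line i l)) (-‿cong (*-congˡ (x-on-line o₀ l))))
                      (-‿cong (*-congˡ (x-on-line o₁ l))) ⟩
          Δ * 0# - σ i * 0# - τ i * 0#
            ≈⟨ solve 3 (λ a b c → a :* con (+ 0) :- b :* con (+ 0) :- c :* con (+ 0) := con (+ 0)) refl Δ (σ i) (τ i) ⟩
          0# ∎)
        killed₀ : f₀ y ≈ 0#
        killed₀ = trans (linear (P (u o₀))) (solve 6 (λ a₀ a₁ aᵢ b₀ b₁ bᵢ →
          (a₀ :* b₁ :- a₁ :* b₀) :* aᵢ :- (aᵢ :* b₁ :- a₁ :* bᵢ) :* a₀ :- (a₀ :* bᵢ :- aᵢ :* b₀) :* a₁ := con (+ 0))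
          refl (f₀ (x o₀)) (f₀ (x o₁)) (f₀ (x i)) (f₁ (x o₀)) (f₁ (x o₁)) (f₁ (x i)))
        killed₁ : f₁ y ≈ 0#
        killed₁ = trans (linear (P (u o₁))) (solve 6 (λ a₀ a₁ aᵢ b₀ b₁ bᵢ →
          (a₀ :* b₁ :- a₁ :* b₀) :* bᵢ :- (aᵢ :* b₁ :- a₁ :* bᵢ) :* b₀ :- (a₀ :* bᵢ :- aᵢ :* b₀) :* b₁ := con (+ 0))
          refl (f₀ (x o₀)) (f₀ (x o₁)) (f₀ (x i)) (f₁ (x o₀)) (f₁ (x o₁)) (f₁ (x i)))
        y≈0 : ∀ l → y l ≈ 0#
        y≈0 = on-line-zero {o₀} {o₁} (λ ()) y y-on-line killed₀ killed₁

      -- the coordinates of distinct points are not proportional (Plücker relation)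
      coordinates-apart : ∀ i j → i ≢ j → ¬ (σ i * τ j - τ i * σ j ≈ 0#)
      coordinates-apart i j i≢j σᵢτⱼ≈τᵢσⱼ = *-nonzero Δ≉0 (bracket-nonzero o₀ o₁ i j (λ ()) i≢j) (trans
        (solve 8 (λ a₀ a₁ aᵢ aⱼ b₀ b₁ bᵢ bⱼ →
           (a₀ :* b₁ :- a₁ :* b₀) :* (aᵢ :* bⱼ :- aⱼ :* bᵢ)
           := (aᵢ :* b₁ :- a₁ :* bᵢ) :* (a₀ :* bⱼ :- aⱼ :* b₀) :- (a₀ :* bᵢ :- aᵢ :* b₀) :* (aⱼ :* b₁ :- a₁ :* bⱼ))
           refl (f₀ (x o₀)) (f₀ (x o₁)) (f₀ (x i)) (f₀ (x j)) (f₁ (x o₀)) (f₁ (x o₁)) (f₁ (x i)) (f₁ (x j)))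
        σᵢτⱼ≈τᵢσⱼ)

      -- Written in these coordinates, ψ becomes the binary form
      --   G(σ, τ) = Σ_w λ_w ∏_{v ≠ w} (P_v σ + Q_v τ),
      -- with P_v, Q_v the values of form v at x_{o₀}, x_{o₁}; G has degree d+1.
      module _ (lam : Fin (suc (suc d)) → Carrier) where

        at₀ at₁ : Fin (suc (suc d)) → Carrier
        at₀ v = form v (x o₀)
        at₁ v = form v (x o₁)

        linearForm : Fin (suc (suc d)) → Fun₂
        linearForm v s t = at₀ v * s + at₁ v * t

        -- the product of the linear forms other than the w-th, at the zero of the w-th
        complement : Fin (suc (suc d)) → Carrier
        complement w = ∏ (λ v → linearForm (punchIn w v) (at₁ w) (- at₀ w))

        G : Fun₂
        G s t = ∑ (λ w → lam w * ∏ (λ v → linearForm (punchIn w v) s t))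

        G-form : IsForm (suc d) G
        G-form = ∑-form (suc d) (λ w s t → lam w * ∏ (λ v → linearForm (punchIn w v) s t))
          (λ w → scale-form (suc d) (lam w) (∏-linear-form (λ v → at₀ (punchIn w v)) (λ v → at₁ (punchIn w v))))

        G-at-point : ∀ i → G (σ i) (τ i) ≈ Δ ^ suc d * ψ lam (λ w → P (u w)) (x i)
        G-at-point i = begin
          ∑ (λ w → lam w * ∏ (λ v → linearForm (punchIn w v) (σ i) (τ i)))
            ≈⟨ ∑-cong (λ w → *-congˡ {lam w} (∏-cong (λ v →
                 trans (+-cong (*-comm _ _) (*-comm _ _)) (sym (coordinates i (punchIn w v)))))) ⟩
          ∑ (λ w → lam w * ∏ (λ v → Δ * form (punchIn w v) (x i)))
            ≈⟨ ∑-cong (λ w → trans (*-congˡ (∏-scale Δ (λ v → form (punchIn w v) (x i))))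
                 (solve 3 (λ l d p → l :* (d :* p) := d :* (l :* p)) refl
                        (lam w) (Δ ^ suc d) (∏ (λ v → form (punchIn w v) (x i))))) ⟩
          ∑ (λ w → Δ ^ suc d * (lam w * ∏ (λ v → form (punchIn w v) (x i))))
            ≈⟨ ∑-*ˡ (Δ ^ suc d) (λ w → lam w * ∏ (λ v → form (punchIn w v) (x i))) ⟨
          Δ ^ suc d * ∑ (λ w → lam w * ∏ (λ v → form (punchIn w v) (x i)))
            ≈⟨ *-congˡ (∑-cong (λ w → *-congˡ {lam w} (∏-skip w (λ v → form v (x i))))) ⟨
          Δ ^ suc d * ψ lam (λ w → P (u w)) (x i) ∎

        -- G vanishes at the d+2 points (σ_i, τ_i); the first is at infinity
        -- (τ_{o₀} = 0), the others are finite and pairwise apart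
        G-zero : (∀ i → ψ lam (λ w → P (u w)) (x i) ≈ 0#) → ∀ s t → G s t ≈ 0#
        G-zero ψ-roots = root-bound-∞ d G-form (σ o₀) (τ o₀) Δ≉0 τ₀≈0 (G-root o₀)
          (λ i → σ (suc i)) (λ i → τ (suc i)) τ≉0
          (λ i j i≢j → coordinates-apart (suc i) (suc j) (λ e → i≢j (Fin.suc-injective e)))
          (λ i → G-root (suc i))
          where
          G-root : ∀ i → G (σ i) (τ i) ≈ 0#
          G-root i = trans (G-at-point i) (trans (*-congˡ (ψ-roots i)) (zeroʳ _))
          τ₀≈0 : τ o₀ ≈ 0#
          τ₀≈0 = solve 2 (λ a b → a :* b :- a :* b := con (+ 0)) refl (form o₀ (x o₀)) (form o₁ (x o₀))
          τ≉0 : ∀ i → ¬ (τ (suc i) ≈ 0#)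
          τ≉0 i = bracket-nonzero o₀ o₁ o₀ (suc i) (λ ()) (λ ())

        -- evaluating G at the zero (Q_w, -P_w) of the w-th linear form isolates λ_w
        G-isolates : ∀ w → G (at₁ w) (- at₀ w) ≈ lam w * complement w
        G-isolates w = ∑-single (λ w′ → lam w′ * ∏ (λ v → linearForm (punchIn w′ v) (at₁ w) (- at₀ w))) w
          (λ w′ w′≢w → trans (*-congˡ (∏-zero (λ v → linearForm (punchIn w′ v) (at₁ w) (- at₀ w)) (punchOut w′≢w)
            (trans (reflexive (≡.cong (λ v → linearForm v (at₁ w) (- at₀ w)) (Fin.punchIn-punchOut w′≢w)))
                   linearForm-w-zero))) (zeroʳ _))
          where
          linearForm-w-zero : linearForm w (at₁ w) (- at₀ w) ≈ 0#
          linearForm-w-zero = solve 2 (λ p q → p :* q :+ q :* (:- p) := con (+ 0)) refl (at₀ w) (at₁ w)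

        -- ... and the remaining product is nonzero, as distinct forms are independent on the line
        complement-nonzero : ∀ w → ¬ (complement w ≈ 0#)
        complement-nonzero w = ∏-nonzero _ λ v linear≈0 →
          bracket-nonzero (punchIn w v) w o₀ o₁ (Fin.punchInᵢ≢i w v) (λ ())
            (trans (solve 4 (λ pv qv pw qw → pv :* qw :- qv :* pw := pv :* qw :+ qv :* (:- pw)) refl
                            (at₀ (punchIn w v)) (at₁ (punchIn w v)) (at₀ w) (at₁ w)) linear≈0)

        all-coefficients-zero : (∀ i → ψ lam (λ w → P (u w)) (x i) ≈ 0#) → ∀ w → lam w ≈ 0#
        all-coefficients-zero ψ-roots w = cancelˡ (complement-nonzero w)
          (trans (*-comm _ _) (trans (sym (G-isolates w)) (G-zero ψ-roots _ _)))

lemma2p3 : ∀ {c ℓ} (F : FiniteField c ℓ) → let open Geometry F in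
    (k n N : ℕ) → 2 ≤ k →
    (P : Fin N → Vect k) → IsArc P →
    (a : Fin (k ∸ 2) → Fin N) → (∀ i j → a i ≡ a j → i ≡ j) →
    (u : Fin (suc n) → Fin N) → (∀ i j → u i ≡ u j → i ≡ j) →
    (∀ i j → a i ≢ u j) →
    (lam : Fin (suc n) → Carrier) →
    (x : Fin (suc n) → Vect k) →
    (∀ i → ¬ (∀ j → x i j ≈ 0#)) →
    (∀ i l → (P (a l) · x i) ≈ 0#) →
    (∀ i j → i ≢ j → ¬ Σ Carrier (λ t → ∀ l → x i l ≈ (t * x j l))) →
    (∀ i → ψ lam (λ w → P (u w)) (x i) ≈ 0#) →
    ∀ w → lam w ≈ 0#
lemma2p3 F (suc (suc m)) zero N (s≤s (s≤s z≤n)) P _ _ _ u _ _ lam x _ _ _ ψ-roots zero =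
  trans (sym (ψ-single lam (λ w → P (u w)) (x zero))) (ψ-roots zero)
  where
  open FiniteField F using (trans; sym)
  open ArcConfiguration F using (ψ-single)
lemma2p3 F (suc (suc m)) (suc d) N (s≤s (s≤s z≤n))
         P arc a a-injective u u-injective a≢u lam x x≉0 x-on-line x-distinct ψ-roots =
  ArcConfiguration.all-coefficients-zero F m d N P arc a a-injective u u-injective a≢u
    x x≉0 x-on-line x-distinct lam ψ-roots
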